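{- Let $G$ be a chordal graph. The following are equivalent: (i) for every induced subgraph $G'$ of $G$ and every two members $S_i, S_j$ ($i\neq j$) of the multiset $\mathbf{S}(G')$, we have $S_i\neq S_j$; (ii) $G$ is claw-free.
   Context: Graphs are simple, finite and undirected; a graph is chordal if it has no induced cycle of length at least four. A clique is a maximal set of pairwise adjacent vertices. A clique tree of a connected chordal graph $G$ is a tree $\mathcal{T}$ whose vertices are the cliques of $G$ such that for any two cliques $C_1,C_2$, every clique on the path from $C_1$ to $C_2$ in $\mathcal{T}$ contains $C_1\cap C_2$. Each edge of a clique tree is labeled by the intersection of its two endpoint cliques; these labels are exactly the minimal vertex separators. $\mathbf{S}(G)$ denotes the multiset of edge labels of a clique tree (taken over all connected components of $G$); it does not depend on the choice of clique tree. The claw is $K_{1,3}$. A graph is $H$-free if it has no induced subgraph isomorphic to $H$. -}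

module Defs where

open import Data.Nat using (ℕ; zero; suc; _≤_)
open import Data.Fin using (Fin; toℕ; fromℕ; inject₁) renaming (zero to fzero; suc to fsuc)
open import Data.Fin.Subset using (Subset; _∈_; _⊆_; _∩_; Nonempty)
open import Data.Bool using (Bool; true; false)
open import Data.Product using (Σ; ∃; _×_; _,_)
open import Data.Sum using (_⊎_)
open import Relation.Nullary using (¬_)
open import Relation.Binary.PropositionalEquality using (_≡_; _≢_)
open import Function.Definitions using (Injective)

record Graph (n : ℕ) : Set where
  field
    adj    : Fin n → Fin n → Bool
    sym    : ∀ u v → adj u v ≡ adj v u
    irrefl : ∀ v → adj v v ≡ false

open Graph public

Adj : ∀ {n} → Graph n → Fin n → Fin n → Set
Adj G u v = adj G u v ≡ true

Succ : (k : ℕ) → Fin k → Fin k → Set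
Succ k i j = (suc (toℕ i) ≡ toℕ j) ⊎ ((suc (toℕ i) ≡ k) × (toℕ j ≡ 0))

CycAdj : (k : ℕ) → Fin k → Fin k → Set
CycAdj k i j = Succ k i j ⊎ Succ k j i

Chordal : ∀ {n} → Graph n → Set
Chordal {n} G =
  ∀ (k : ℕ) → 4 ≤ k → (v : Fin k → Fin n) → Injective _≡_ _≡_ v →
  ¬ (∀ i j → (Adj G (v i) (v j) → CycAdj k i j) × (CycAdj k i j → Adj G (v i) (v j)))

ClawFree : ∀ {n} → Graph n → Set
ClawFree {n} G =
  ¬ (Σ (Fin n) λ a → Σ (Fin n) λ b → Σ (Fin n) λ c → Σ (Fin n) λ d →
       (b ≢ c) × (b ≢ d) × (c ≢ d) ×
       Adj G a b × Adj G a c × Adj G a d ×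
       ¬ Adj G b c × ¬ Adj G b d × ¬ Adj G c d)

-- The induced subgraph G[U] is represented by the vertex subset U.
-- C is a complete subset of G[U].
IsComplete : ∀ {n} → Graph n → Subset n → Subset n → Set
IsComplete G U C = C ⊆ U × (∀ u v → u ∈ C → v ∈ C → u ≢ v → Adj G u v)

IsClique : ∀ {n} → Graph n → Subset n → Subset n → Set
IsClique G U C =
  Nonempty C × IsComplete G U C × (∀ D → IsComplete G U D → C ⊆ D → D ≡ C)

data Reach {n} (G : Graph n) (U : Subset n) (u : Fin n) : Fin n → Set where
  here : u ∈ U → Reach G U u u
  step : ∀ {v w} → Reach G U u v → w ∈ U → Adj G v w → Reach G U u w

SameComp : ∀ {n} → Graph n → Subset n → Subset n → Subset n → Set
SameComp {n} G U C D = Σ (Fin n) λ u → Σ (Fin n) λ v → u ∈ C × v ∈ D × Reach G U u v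

record TPath {m : ℕ} (tadj : Fin m → Fin m → Bool) (x y : Fin m) : Set where
  field
    len    : ℕ
    vert   : Fin (suc len) → Fin m
    inj    : Injective _≡_ _≡_ vert
    start  : vert fzero ≡ x
    finish : vert (fromℕ len) ≡ y
    edges  : ∀ (t : Fin len) → tadj (vert (inject₁ t)) (vert (fsuc t)) ≡ true

-- A clique forest of G[U]: the disjoint union of clique trees of the
-- connected components of G[U]. Its nodes are indexed by Fin m via a
-- bijection cl onto the cliques of G[U].
record CliqueForest {n} (G : Graph n) (U : Subset n) : Set where
  field
    m        : ℕ
    cl       : Fin m → Subset n
    cl-clique : ∀ i → IsClique G U (cl i)
    cl-inj   : Injective _≡_ _≡_ cl
    cl-surj  : ∀ C → IsClique G U C → ∃ λ i → cl i ≡ C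
    tadj     : Fin m → Fin m → Bool
    tsym     : ∀ i j → tadj i j ≡ tadj j i
    tirrefl  : ∀ i → tadj i i ≡ false
    acyclic  : ∀ (k : ℕ) → 3 ≤ k → (c : Fin k → Fin m) → Injective _≡_ _≡_ c →
               ¬ (∀ i j → Succ k i j → tadj (c i) (c j) ≡ true)
    connected : ∀ i j → SameComp G U (cl i) (cl j) → TPath tadj i j
    separated : ∀ i j → tadj i j ≡ true → SameComp G U (cl i) (cl j)
    path-prop : ∀ i j (p : TPath tadj i j) (t : Fin (suc (TPath.len p))) →
                (cl i ∩ cl j) ⊆ cl (TPath.vert p t)

-- Any two distinct edges of the forest have distinct labels, i.e. the
-- multiset S(G[U]) of edge labels has no repeated member.
DistinctLabels : ∀ {n} {G : Graph n} {U : Subset n} → CliqueForest G U → Set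
DistinctLabels F =
  ∀ a b c d → tadj a b ≡ true → tadj c d ≡ true →
  (cl a ∩ cl b) ≡ (cl c ∩ cl d) → ((a ≡ c) × (b ≡ d)) ⊎ ((a ≡ d) × (b ≡ c))
  where open CliqueForest F

module Submission where

-- (⇐) Let {a,b} ≠ {c,d} be forest edges with the same label S.  S is nonempty
-- (an edge joins cliques of one component), so pick s ∈ S.  Removing the edge
-- {a,b} splits the forest into an a-side and a b-side; the edge {c,d} lies
-- entirely on one side, say a's.  Distinct cliques are incomparable, so there
-- are y ∈ b∖a, x ∈ c∖d and z ∈ d∖c.  The clique-tree property forces
-- cliques on opposite sides of an edge to meet only inside its label; from
-- this, x, y, z are pairwise distinct and non-adjacent, while s lies in every
-- clique involved and is adjacent to all three: a claw.
-- (⇒) A claw with centre s and leaves ℓ₀ ℓ₁ ℓ₂ induces a subgraph whose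
-- cliques are the spokes {s,ℓᵢ}; the star with the centre clique {s,ℓ₀} is a
-- clique tree of it, and its two edges both carry the label {s}.

open import Defs renaming (sym to adj-symmetric)
open import Data.Fin.Subset using (Subset)
open import Function.Bundles using (_⇔_; mk⇔)

open import Data.Nat using (ℕ; zero; suc; _≤_; _<_; _+_; z≤n; s≤s)
open import Data.Nat.Properties using (suc-injective; ≤-trans; ≤-reflexive; <⇒≱; +-suc; +-identityʳ; +-monoˡ-≤; m≤n+m)
open import Data.Fin using (Fin; toℕ; fromℕ; inject₁; _≟_) renaming (zero to fzero; suc to fsuc)
open import Data.Fin.Properties using (toℕ-injective; toℕ-inject₁; toℕ-fromℕ; any?; all?)
open import Data.Fin.Subset using (_∈_; _∉_; _⊆_; _∩_; _∪_; ⁅_⁆; Nonempty; ∣_∣) renaming (⊥ to ∅)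
open import Data.Fin.Subset.Properties using (_∈?_; ∉⊥; x∈⁅x⁆; x∈⁅y⁆⇒x≡y; ⊆-antisym; p⊂q⇒∣p∣<∣q∣; ∣p∣≤n; x∈p∩q⁺; x∈p∩q⁻; p⊆p∪q; x∈p∪q⁺; x∈p∪q⁻)
open import Data.Bool using (Bool; true; false)
open import Data.Bool.Properties using () renaming (_≟_ to _≟ᵇ_)
open import Data.Product using (Σ; ∃; _×_; _,_; proj₁; proj₂)
open import Data.Sum using (_⊎_; inj₁; inj₂)
open import Data.Empty using (⊥; ⊥-elim)
open import Data.Unit using (⊤; tt)
open import Relation.Nullary using (¬_; Dec; yes; no)
open import Relation.Nullary.Decidable using (_×-dec_; _→-dec_; ¬?)
open import Relation.Binary.PropositionalEquality using (_≡_; _≢_; refl; sym; trans; cong; subst; subst₂)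
open import Function.Definitions using (Injective)
open import Function using (_∘_; id)

module _ {n : ℕ} (G : Graph n) where

  adj-sym : ∀ {u v} → Adj G u v → Adj G v u
  adj-sym {u} {v} a = trans (adj-symmetric G v u) a

  adj-irrefl : ∀ {u v} → Adj G u v → u ≢ v
  adj-irrefl {u} a refl with trans (sym a) (irrefl G u)
  ... | ()

  adj? : ∀ u v → Dec (Adj G u v)
  adj? u v = adj G u v ≟ᵇ true

Claw : ∀ {n} → Graph n → Set
Claw {n} G =
  Σ (Fin n) λ a → Σ (Fin n) λ b → Σ (Fin n) λ c → Σ (Fin n) λ d →
    (b ≢ c) × (b ≢ d) × (c ≢ d) ×
    Adj G a b × Adj G a c × Adj G a d ×
    ¬ Adj G b c × ¬ Adj G b d × ¬ Adj G c d

∈-pair : ∀ {n} {a b v : Fin n} → v ∈ ⁅ a ⁆ ∪ ⁅ b ⁆ → v ≡ a ⊎ v ≡ b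
∈-pair {a = a} {b} h with x∈p∪q⁻ ⁅ a ⁆ ⁅ b ⁆ h
... | inj₁ va = inj₁ (x∈⁅y⁆⇒x≡y a va)
... | inj₂ vb = inj₂ (x∈⁅y⁆⇒x≡y b vb)

pair-left : ∀ {n} (a b : Fin n) → a ∈ ⁅ a ⁆ ∪ ⁅ b ⁆
pair-left a b = x∈p∪q⁺ (inj₁ (x∈⁅x⁆ a))

pair-right : ∀ {n} (a b : Fin n) → b ∈ ⁅ a ⁆ ∪ ⁅ b ⁆
pair-right a b = x∈p∪q⁺ (inj₂ (x∈⁅x⁆ b))

image : ∀ {n L} → (Fin L → Fin n) → Subset n
image {L = zero} f = ∅
image {L = suc L} f = ⁅ f fzero ⁆ ∪ image (f ∘ fsuc)

∈-image : ∀ {n L} (f : Fin L → Fin n) i → f i ∈ image f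
∈-image f fzero = x∈p∪q⁺ (inj₁ (x∈⁅x⁆ (f fzero)))
∈-image f (fsuc i) = x∈p∪q⁺ (inj₂ (∈-image (f ∘ fsuc) i))

image-∈ : ∀ {n L} (f : Fin L → Fin n) {v} → v ∈ image f → ∃ λ i → v ≡ f i
image-∈ {L = zero} f h = ⊥-elim (∉⊥ h)
image-∈ {L = suc L} f h with x∈p∪q⁻ ⁅ f fzero ⁆ (image (f ∘ fsuc)) h
... | inj₁ h₀ = fzero , x∈⁅y⁆⇒x≡y (f fzero) h₀
... | inj₂ h₁ with image-∈ (f ∘ fsuc) h₁
... | i , eq = fsuc i , eq

Acyclic : ∀ {m} → (Fin m → Fin m → Bool) → Set
Acyclic {m} tadj =
  ∀ (k : ℕ) → 3 ≤ k → (c : Fin k → Fin m) → Injective _≡_ _≡_ c →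
  ¬ (∀ i j → Succ k i j → tadj (c i) (c j) ≡ true)

closed-path-trivial : ∀ {m} {tadj : Fin m → Fin m → Bool} {i} (P : TPath tadj i i) t →
                      TPath.vert P t ≡ i
closed-path-trivial P t =
  trans (cong (TPath.vert P) (only-vertex (TPath.len P) t
          (TPath.inj P (trans (TPath.start P) (sym (TPath.finish P))))))
        (TPath.start P)
  where
  only-vertex : ∀ L (t : Fin (suc L)) → fzero ≡ fromℕ L → t ≡ fzero
  only-vertex zero fzero _ = refl
  only-vertex (suc L) t ()

inner-step : ∀ {L} (i j : Fin (suc L)) → suc (toℕ i) ≡ toℕ j → Σ (Fin L) λ t → inject₁ t ≡ i × fsuc t ≡ j
inner-step i (fsuc t) eq = t , toℕ-injective (trans (toℕ-inject₁ t) (sym (suc-injective eq))) , refl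

last-step : ∀ {L} (i : Fin (suc L)) → suc (toℕ i) ≡ suc L → i ≡ fromℕ L
last-step {L} i eq = toℕ-injective (trans (suc-injective eq) (sym (toℕ-fromℕ L)))

module Walks {m : ℕ} (tadj : Fin m → Fin m → Bool) (tsym : ∀ i j → tadj i j ≡ tadj j i) where

  E : Fin m → Fin m → Set
  E i j = tadj i j ≡ true

  E-sym : ∀ {i j} → E i j → E j i
  E-sym {i} {j} e = trans (tsym j i) e

  infixr 5 _∷_ _++_
  data Walk : Fin m → Fin m → Set where
    []  : ∀ {i} → Walk i i
    _∷_ : ∀ {i k j} → E i k → Walk k j → Walk i j

  _++_ : ∀ {i j k} → Walk i j → Walk j k → Walk i k
  [] ++ w = w
  (e ∷ v) ++ w = e ∷ (v ++ w)

  reverse : ∀ {i j} → Walk i j → Walk j i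
  reverse [] = []
  reverse (e ∷ w) = reverse w ++ (E-sym e ∷ [])

  length : ∀ {i j} → Walk i j → ℕ
  length [] = 0
  length (e ∷ w) = suc (length w)

  AllSteps : (Fin m → Fin m → Set) → ∀ {i j} → Walk i j → Set
  AllSteps R [] = ⊤
  AllSteps R (_∷_ {i} {k} e w) = R i k × AllSteps R w

  all-++ : ∀ R {i j k} (v : Walk i j) (w : Walk j k) → AllSteps R v → AllSteps R w → AllSteps R (v ++ w)
  all-++ R [] w _ aw = aw
  all-++ R (e ∷ v) w (r , av) aw = r , all-++ R v w av aw

  all-reverse : ∀ R → (∀ {u v} → R u v → R v u) → ∀ {i j} (w : Walk i j) → AllSteps R w → AllSteps R (reverse w)
  all-reverse R R-sym [] _ = tt
  all-reverse R R-sym (e ∷ w) (r , aw) = all-++ R (reverse w) _ (all-reverse R R-sym w aw) (R-sym r , tt)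

  all-map : ∀ {R R′ : Fin m → Fin m → Set} → (∀ {u v} → R u v → R′ u v) → ∀ {i j} (w : Walk i j) → AllSteps R w → AllSteps R′ w
  all-map f [] _ = tt
  all-map f (e ∷ w) (r , a) = f r , all-map f w a

  OffEdge : Fin m → Fin m → Fin m → Fin m → Set
  OffEdge p q u v = ¬ (u ≡ p × v ≡ q) × ¬ (u ≡ q × v ≡ p)

  off-flip : ∀ {p q u v} → OffEdge p q u v → OffEdge p q v u
  off-flip (a , b) = (λ { (x , y) → b (y , x) }) , (λ { (x , y) → a (y , x) })

  off-swap : ∀ {p q u v} → OffEdge p q u v → OffEdge q p u v
  off-swap (a , b) = b , a

  departs : ∀ {p q u v} → u ≢ p → u ≢ q → OffEdge p q u v
  departs u≢p u≢q = (λ x → u≢p (proj₁ x)) , (λ x → u≢q (proj₁ x))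

  Avoids : Fin m → Fin m → ∀ {i j} → Walk i j → Set
  Avoids p q = AllSteps (OffEdge p q)

  Side : Fin m → Fin m → Fin m → Set
  Side p q k = Σ (Walk k p) (Avoids p q)

  at-endpoint : ∀ {p q} → Side p q p
  at-endpoint = [] , tt

  -- Cut a walk at its first visit to p or q: either it never crosses {p,q},
  -- or its start lies on the side of the endpoint visited first.
  first-endpoint : ∀ p q {k j} (w : Walk k j) → Avoids p q w ⊎ (Side p q k ⊎ Side q p k)
  first-endpoint p q [] = inj₁ tt
  first-endpoint p q (_∷_ {k} e w) with k ≟ p | k ≟ q
  ... | yes refl | _ = inj₂ (inj₁ at-endpoint)
  ... | no _ | yes refl = inj₂ (inj₂ at-endpoint)
  ... | no k≢p | no k≢q with first-endpoint p q w
  ...   | inj₁ av = inj₁ (departs k≢p k≢q , av)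
  ...   | inj₂ (inj₁ (w′ , av)) = inj₂ (inj₁ (e ∷ w′ , departs k≢p k≢q , av))
  ...   | inj₂ (inj₂ (w′ , av)) = inj₂ (inj₂ (e ∷ w′ , departs k≢q k≢p , av))

  side : ∀ p q {k} → Walk k q → Side p q k ⊎ Side q p k
  side p q w with first-endpoint p q w
  ... | inj₁ av = inj₂ (w , all-map off-swap w av)
  ... | inj₂ s = s

  _∈ʷ_ : Fin m → ∀ {i j} → Walk i j → Set
  _∈ʷ_ x {i} [] = x ≡ i
  _∈ʷ_ x {i} (e ∷ w) = x ≡ i ⊎ x ∈ʷ w

  _∈ʷ?_ : ∀ x {i j} (w : Walk i j) → Dec (x ∈ʷ w)
  _∈ʷ?_ x {i} [] = x ≟ i
  _∈ʷ?_ x {i} (e ∷ w) with x ≟ i | x ∈ʷ? w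
  ... | yes p | _ = yes (inj₁ p)
  ... | no _ | yes p = yes (inj₂ p)
  ... | no a | no b = no λ { (inj₁ z) → a z ; (inj₂ z) → b z }

  start-∈ʷ : ∀ {i j} (w : Walk i j) → i ∈ʷ w
  start-∈ʷ [] = refl
  start-∈ʷ (e ∷ w) = inj₁ refl

  Simple : ∀ {i j} → Walk i j → Set
  Simple [] = ⊤
  Simple {i} (e ∷ w) = ¬ i ∈ʷ w × Simple w

  suffix : ∀ x {i j} (w : Walk i j) → x ∈ʷ w →
           Σ (Walk x j) λ w′ → (Simple w → Simple w′) × (∀ R → AllSteps R w → AllSteps R w′)
  suffix x [] refl = [] , (λ _ → tt) , λ _ _ → tt
  suffix x (e ∷ w) (inj₁ refl) = (e ∷ w) , id , λ _ a → a
  suffix x (e ∷ w) (inj₂ h) with suffix x w h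
  ... | w′ , s , a = w′ , (λ si → s (proj₂ si)) , λ R al → a R (proj₂ al)

  simplify : ∀ {i j} (w : Walk i j) → Σ (Walk i j) λ w′ → Simple w′ × (∀ R → AllSteps R w → AllSteps R w′)
  simplify [] = [] , tt , λ _ _ → tt
  simplify (_∷_ {i} e w) with simplify w
  ... | w′ , s , a with i ∈ʷ? w′
  ...   | no i∉w′ = (e ∷ w′) , (i∉w′ , s) , λ R al → proj₁ al , a R (proj₂ al)
  ...   | yes i∈w′ with suffix i w′ i∈w′
  ...     | w″ , s′ , a′ = w″ , s′ s , λ R al → a′ R (a R (proj₂ al))

  avoids-or-visits : ∀ p q {i j} (w : Walk i j) → Avoids p q w ⊎ (p ∈ʷ w × q ∈ʷ w)
  avoids-or-visits p q [] = inj₁ tt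
  avoids-or-visits p q (_∷_ {i} {k} e w) with (i ≟ p) ×-dec (k ≟ q) | (i ≟ q) ×-dec (k ≟ p)
  ... | yes (refl , refl) | _ = inj₂ (inj₁ refl , inj₂ (start-∈ʷ w))
  ... | no _ | yes (refl , refl) = inj₂ (inj₂ (start-∈ʷ w) , inj₁ refl)
  ... | no a | no b with avoids-or-visits p q w
  ...   | inj₂ (x , y) = inj₂ (inj₂ x , inj₂ y)
  ...   | inj₁ av = inj₁ ((a , b) , av)

  trivial-path : ∀ i → TPath tadj i i
  trivial-path i = record
    { len = 0 ; vert = λ _ → i ; inj = λ { {fzero} {fzero} _ → refl }
    ; start = refl ; finish = refl ; edges = λ () }

  cons-path : ∀ {i k j} → E i k → (P : TPath tadj k j) → (∀ t → TPath.vert P t ≢ i) → TPath tadj i j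
  cons-path {i} e P fresh = record
    { len = suc (TPath.len P) ; vert = vert ; inj = inj
    ; start = refl ; finish = TPath.finish P ; edges = edges }
    where
    vert : Fin (suc (suc (TPath.len P))) → Fin m
    vert fzero = i
    vert (fsuc t) = TPath.vert P t
    inj : Injective _≡_ _≡_ vert
    inj {fzero} {fzero} _ = refl
    inj {fzero} {fsuc y} eq = ⊥-elim (fresh y (sym eq))
    inj {fsuc x} {fzero} eq = ⊥-elim (fresh x eq)
    inj {fsuc x} {fsuc y} eq = cong fsuc (TPath.inj P eq)
    edges : ∀ t → tadj (vert (inject₁ t)) (vert (fsuc t)) ≡ true
    edges fzero = subst (λ z → tadj i z ≡ true) (sym (TPath.start P)) e
    edges (fsuc t) = TPath.edges P t

  record Trace {i j} (w : Walk i j) : Set where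
    field
      path        : TPath tadj i j
      inside      : ∀ t → TPath.vert path t ∈ʷ w
      covers      : ∀ x → x ∈ʷ w → ∃ λ t → TPath.vert path t ≡ x
      same-length : TPath.len path ≡ length w

  trace : ∀ {i j} (w : Walk i j) → Simple w → Trace w
  trace {i} [] _ = record
    { path = trivial-path i ; inside = λ _ → refl
    ; covers = λ x h → fzero , sym h ; same-length = refl }
  trace {i} {j} (e ∷ w) (i∉w , simple) = record
    { path = P′ ; inside = inside′ ; covers = covers′ ; same-length = cong suc same-length }
    where
    open Trace (trace w simple)
    P′ : TPath tadj i j
    P′ = cons-path e path (λ t eq → i∉w (subst (_∈ʷ w) eq (inside t)))
    inside′ : ∀ t → TPath.vert P′ t ∈ʷ (e ∷ w)
    inside′ fzero = inj₁ refl
    inside′ (fsuc t) = inj₂ (inside t)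
    covers′ : ∀ x → x ∈ʷ (e ∷ w) → ∃ λ t → TPath.vert P′ t ≡ x
    covers′ x (inj₁ h) = fzero , sym h
    covers′ x (inj₂ h) with covers x h
    ... | t , eq = fsuc t , eq

  path-walk : ∀ {i j} → TPath tadj i j → Walk i j
  path-walk P = subst₂ Walk (TPath.start P) (TPath.finish P)
                  (along (TPath.len P) (TPath.vert P) (TPath.edges P))
    where
    along : ∀ L (f : Fin (suc L) → Fin m) → (∀ t → tadj (f (inject₁ t)) (f (fsuc t)) ≡ true) →
            Walk (f fzero) (f (fromℕ L))
    along zero f ed = []
    along (suc L) f ed = ed fzero ∷ along L (f ∘ fsuc) (ed ∘ fsuc)

  closing-cycle : ∀ {p q} (P : TPath tadj p q) → E q p → ∀ i j → Succ (suc (TPath.len P)) i j →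
                  tadj (TPath.vert P i) (TPath.vert P j) ≡ true
  closing-cycle P e i j (inj₁ eq) with inner-step i j eq
  ... | t , refl , refl = TPath.edges P t
  closing-cycle P e i fzero (inj₂ (last , _))
    rewrite last-step i last | TPath.start P | TPath.finish P = e

  -- In an acyclic loopless graph every edge is a bridge, so the two sides of
  -- an edge are disjoint.
  module Tree (acyclic : Acyclic tadj) (loopless : ∀ i → tadj i i ≡ false) where

    no-loop : ∀ {p} → ¬ E p p
    no-loop {p} e with trans (sym e) (loopless p)
    ... | ()

    -- A p–q walk avoiding the edge {p,q}, made simple, would close a cycle
    -- of length ≥ 3 with it.
    edge-is-bridge : ∀ {p q} → E p q → (w : Walk p q) → ¬ Avoids p q w
    edge-is-bridge {p} {q} e w av with simplify w
    ... | w′ , simple , steps = no-detour w′ simple (steps (OffEdge p q) av)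
      where
      no-detour : (w′ : Walk p q) → Simple w′ → ¬ Avoids p q w′
      no-detour [] _ _ = no-loop e
      no-detour (e₁ ∷ []) _ ((off , _) , _) = off (refl , refl)
      no-detour (e₁ ∷ e₂ ∷ w″) simple′ _ =
        acyclic (suc (TPath.len path))
          (subst (λ L → 3 ≤ suc L) (sym same-length) (s≤s (s≤s (s≤s z≤n))))
          (TPath.vert path) (TPath.inj path) (closing-cycle path (E-sym e))
        where open Trace (trace (e₁ ∷ e₂ ∷ w″) simple′)

    sides-disjoint : ∀ {p q k} → E p q → Side p q k → Side q p k → ⊥
    sides-disjoint e (w₁ , a₁) (w₂ , a₂) = edge-is-bridge e (reverse w₁ ++ w₂)
      (all-++ _ (reverse w₁) w₂ (all-reverse _ off-flip w₁ a₁) (all-map off-swap w₂ a₂))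

module Cliques {n : ℕ} (G : Graph n) (U : Subset n) where

  Extends : Subset n → Fin n → Set
  Extends D v = v ∈ U × v ∉ D × (∀ u → u ∈ D → Adj G u v)

  extends? : ∀ D v → Dec (Extends D v)
  extends? D v = (v ∈? U) ×-dec ¬? (v ∈? D) ×-dec all? (λ u → (u ∈? D) →-dec adj? G u v)

  add-complete : ∀ D v → IsComplete G U D → Extends D v → IsComplete G U (D ∪ ⁅ v ⁆)
  add-complete D v (D⊆U , D-comp) (vU , v∉D , v-adj) = sub , comp
    where
    sub : D ∪ ⁅ v ⁆ ⊆ U
    sub {x} h with x∈p∪q⁻ D ⁅ v ⁆ h
    ... | inj₁ xD = D⊆U xD
    ... | inj₂ xv rewrite x∈⁅y⁆⇒x≡y v xv = vU
    comp : ∀ x y → x ∈ D ∪ ⁅ v ⁆ → y ∈ D ∪ ⁅ v ⁆ → x ≢ y → Adj G x y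
    comp x y hx hy ne with x∈p∪q⁻ D ⁅ v ⁆ hx | x∈p∪q⁻ D ⁅ v ⁆ hy
    ... | inj₁ xD | inj₁ yD = D-comp x y xD yD ne
    ... | inj₁ xD | inj₂ yv rewrite x∈⁅y⁆⇒x≡y v yv = v-adj x xD
    ... | inj₂ xv | inj₁ yD rewrite x∈⁅y⁆⇒x≡y v xv = adj-sym G (v-adj y yD)
    ... | inj₂ xv | inj₂ yv = ⊥-elim (ne (trans (x∈⁅y⁆⇒x≡y v xv) (sym (x∈⁅y⁆⇒x≡y v yv))))

  edge-complete : ∀ {x y} → Adj G x y → x ∈ U → y ∈ U → IsComplete G U (⁅ x ⁆ ∪ ⁅ y ⁆)
  edge-complete {x} {y} a xU yU = sub , comp
    where
    sub : ⁅ x ⁆ ∪ ⁅ y ⁆ ⊆ U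
    sub h with ∈-pair h
    ... | inj₁ refl = xU
    ... | inj₂ refl = yU
    comp : ∀ u v → u ∈ ⁅ x ⁆ ∪ ⁅ y ⁆ → v ∈ ⁅ x ⁆ ∪ ⁅ y ⁆ → u ≢ v → Adj G u v
    comp u v hu hv ne with ∈-pair hu | ∈-pair hv
    ... | inj₁ refl | inj₁ refl = ⊥-elim (ne refl)
    ... | inj₁ refl | inj₂ refl = a
    ... | inj₂ refl | inj₁ refl = adj-sym G a
    ... | inj₂ refl | inj₂ refl = ⊥-elim (ne refl)

  grows : ∀ {D v} → Extends D v → ∣ D ∣ < ∣ D ∪ ⁅ v ⁆ ∣
  grows {D} {v} (_ , v∉D , _) = p⊂q⇒∣p∣<∣q∣ (p⊆p∪q ⁅ v ⁆ , v , x∈p∪q⁺ (inj₂ (x∈⁅x⁆ v)) , v∉D)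

  -- Greedily add vertices until none fits; the fuel bounds the number of
  -- additions, as each one increases ∣ D ∣ ≤ n.
  saturate : (fuel : ℕ) (D : Subset n) → n ≤ ∣ D ∣ + fuel → IsComplete G U D →
             Σ (Subset n) λ C → IsComplete G U C × D ⊆ C × (∀ v → ¬ Extends C v)
  saturate fuel D bound D-comp with any? (extends? D)
  ... | no stuck = D , D-comp , id , λ v e → stuck (v , e)
  saturate zero D bound D-comp | yes (v , e) =
    ⊥-elim (<⇒≱ (grows e) (≤-trans (∣p∣≤n (D ∪ ⁅ v ⁆)) (subst (n ≤_) (+-identityʳ ∣ D ∣) bound)))
  saturate (suc fuel) D bound D-comp | yes (v , e)
    with saturate fuel (D ∪ ⁅ v ⁆) bound′ (add-complete D v D-comp e)
    where
    bound′ : n ≤ ∣ D ∪ ⁅ v ⁆ ∣ + fuel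
    bound′ = ≤-trans bound (≤-trans (≤-reflexive (+-suc ∣ D ∣ fuel)) (+-monoˡ-≤ fuel (grows e)))
  ... | C , C-comp , D∪v⊆C , stuck = C , C-comp , D∪v⊆C ∘ p⊆p∪q ⁅ v ⁆ , stuck

  -- Every nonempty complete set lies in a clique: saturate it, and note that
  -- a complete set that cannot be extended by one vertex is maximal.
  extend-to-clique : ∀ D → IsComplete G U D → Nonempty D → Σ (Subset n) λ C → IsClique G U C × D ⊆ C
  extend-to-clique D D-comp (x , xD) with saturate n D (m≤n+m n ∣ D ∣) D-comp
  ... | C , C-comp , D⊆C , stuck = C , ((x , D⊆C xD) , C-comp , maximal) , D⊆C
    where
    maximal : ∀ D′ → IsComplete G U D′ → C ⊆ D′ → D′ ≡ C
    maximal D′ (D′⊆U , D′-comp) C⊆D′ = ⊆-antisym D′⊆C C⊆D′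
      where
      D′⊆C : D′ ⊆ C
      D′⊆C {y} yD′ with y ∈? C
      ... | yes yC = yC
      ... | no y∉C = ⊥-elim (stuck y (D′⊆U yD′ , y∉C ,
                      λ u uC → D′-comp u y (C⊆D′ uC) yD′ (λ { refl → y∉C uC })))

  edge-in-clique : ∀ {x y} → Adj G x y → x ∈ U → y ∈ U →
                   Σ (Subset n) λ C → IsClique G U C × x ∈ C × y ∈ C
  edge-in-clique {x} {y} a xU yU
    with extend-to-clique (⁅ x ⁆ ∪ ⁅ y ⁆) (edge-complete a xU yU) (x , pair-left x y)
  ... | C , C-clique , xy⊆C = C , C-clique , xy⊆C (pair-left x y) , xy⊆C (pair-right x y)

module Forest {n : ℕ} {G : Graph n} {U : Subset n} (F : CliqueForest G U) where
  open CliqueForest F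
  open Walks tadj tsym
  open Tree acyclic tirrefl
  open Cliques G U

  InLabel : Fin m → Fin m → Fin n → Set
  InLabel p q v = v ∈ cl p × v ∈ cl q

  cl-⊆U : ∀ k → cl k ⊆ U
  cl-⊆U k = proj₁ (proj₁ (proj₂ (cl-clique k)))

  cl-complete : ∀ k u v → u ∈ cl k → v ∈ cl k → u ≢ v → Adj G u v
  cl-complete k = proj₂ (proj₁ (proj₂ (cl-clique k)))

  shared-walk : ∀ {k l v} → v ∈ cl k → v ∈ cl l → Walk k l
  shared-walk {k} {l} {v} vk vl = path-walk (connected k l (v , v , vk , vl , here (cl-⊆U k vk)))

  -- Cliques on opposite sides of an edge meet only inside its label: the
  -- walk k → p → q → l, made simple, passes through p and q (otherwise l
  -- would lie on both sides), and the clique-tree property applies along it.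
  separation : ∀ {p q k l v} → E p q → Side p q k → Side q p l → v ∈ cl k → v ∈ cl l → InLabel p q v
  separation {p} {q} {k} {l} {v} e (wk , ak) (wl , al) vk vl with simplify (wk ++ e ∷ reverse wl)
  ... | W , simple , _ with avoids-or-visits p q W
  ... | inj₁ avoid = ⊥-elim (sides-disjoint e
          (reverse W ++ wk , all-++ _ (reverse W) wk (all-reverse _ off-flip W avoid) ak) (wl , al))
  ... | inj₂ (p∈W , q∈W) = on-path p∈W , on-path q∈W
    where
    open Trace (trace W simple)
    on-path : ∀ {x} → x ∈ʷ W → v ∈ cl x
    on-path x∈W with covers _ x∈W
    ... | t , refl = path-prop k l path t (x∈p∩q⁺ (vk , vl))

  edge-clique : ∀ {x y} → Adj G x y → x ∈ U → y ∈ U → Σ (Fin m) λ r → x ∈ cl r × y ∈ cl r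
  edge-clique a xU yU with edge-in-clique a xU yU
  ... | C , C-clique , xC , yC with cl-surj C C-clique
  ... | r , refl = r , xC , yC

  -- Vertices outside the label, in cliques on opposite sides of an edge, are
  -- distinct and non-adjacent (an edge xy would lie in a clique on one side).
  far-apart : ∀ {p q k l x y} → E p q → Side p q k → Side q p l → x ∈ cl k → y ∈ cl l →
              ¬ InLabel p q x → ¬ InLabel p q y → x ≢ y × ¬ Adj G x y
  far-apart {p} {q} {k} {l} {x} {y} e sk sl xk yl x∉S y∉S =
    (λ { refl → x∉S (separation e sk sl xk yl) }) , non-adjacent
    where
    non-adjacent : ¬ Adj G x y
    non-adjacent a with edge-clique a (cl-⊆U k xk) (cl-⊆U l yl)
    ... | r , xr , yr with side p q (shared-walk yr yl ++ proj₁ sl)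
    ... | inj₁ r-p = y∉S (separation e r-p sl yr yl)
    ... | inj₂ r-q = x∉S (separation e sk r-q xk xr)

  reach-side : ∀ {p q u w} → E p q → u ∈ cl p → Reach G U u w →
               (∃ λ s → InLabel p q s) ⊎ (Σ (Fin m) λ k → w ∈ cl k × Side p q k)
  reach-side {p} e up (here _) = inj₂ (p , up , at-endpoint)
  reach-side {p} {q} e up (step {v} r wU a) with reach-side e up r
  ... | inj₁ s = inj₁ s
  ... | inj₂ (k , vk , sk) with edge-clique a (cl-⊆U k vk) wU
  ... | l , vl , wl with side p q (shared-walk vl vk ++ proj₁ sk ++ e ∷ [])
  ... | inj₁ sl = inj₂ (l , wl , sl)
  ... | inj₂ sl = inj₁ (v , separation e sk sl vk vl)

  -- Forest edges join cliques of one component, so labels are nonempty.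
  label-nonempty : ∀ {p q} → E p q → ∃ λ s → InLabel p q s
  label-nonempty {p} {q} e with separated p q e
  ... | u , v , up , vq , r with reach-side e up r
  ... | inj₁ s = s
  ... | inj₂ (k , vk , sk) = v , separation e sk at-endpoint vk vq

  -- Distinct cliques are incomparable: q has a vertex outside p.
  private-vertex : ∀ {p q} → E p q → Σ (Fin n) λ y → y ∈ cl q × y ∉ cl p
  private-vertex {p} {q} e with any? (λ y → (y ∈? cl q) ×-dec ¬? (y ∈? cl p))
  ... | yes found = found
  ... | no none = ⊥-elim (no-loop (subst (E p) (sym p≡q) e))
    where
    q⊆p : cl q ⊆ cl p
    q⊆p {y} yq with y ∈? cl p
    ... | yes yp = yp
    ... | no y∉p = ⊥-elim (none (y , yq , y∉p))
    p≡q : p ≡ q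
    p≡q = cl-inj (proj₂ (proj₂ (cl-clique q)) (cl p) (proj₁ (proj₂ (cl-clique p))) q⊆p)

  -- The heart of (⇐): an edge {c,d} on p's side of {p,q} whose label contains
  -- that of {p,q} yields a claw centred at a label vertex s, with leaves
  -- x ∈ c∖d, y ∈ q∖p, z ∈ d∖c.  The edge {p,q} separates y from x and z, and
  -- the edge {c,d} separates x from z.
  repeated-label-claw : ∀ {p q c d s} → E p q → E c d → (∀ v → InLabel p q v → InLabel c d v) →
                        InLabel p q s → Side p q c → Side p q d → Claw G
  repeated-label-claw {q = q} {c} {d} {s} epq ecd sub (sp , sq) side-c side-d
    with private-vertex epq | private-vertex (E-sym ecd) | private-vertex ecd
  ... | y , yq , y∉p | x , xc , x∉d | z , zd , z∉c =
    s , x , y , z , proj₁ xy , proj₁ xz , (λ eq → proj₁ zy (sym eq)) ,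
    cl-complete c s x sc xc (λ { refl → x∉d sd }) ,
    cl-complete q s y sq yq (λ { refl → y∉p sp }) ,
    cl-complete d s z sd zd (λ { refl → z∉c sc }) ,
    proj₂ xy , proj₂ xz , (λ a → proj₂ zy (adj-sym G a))
    where
    sc : s ∈ cl c
    sc = proj₁ (sub s (sp , sq))
    sd : s ∈ cl d
    sd = proj₂ (sub s (sp , sq))
    xy : x ≢ y × ¬ Adj G x y
    xy = far-apart epq side-c at-endpoint xc yq (λ S → x∉d (proj₂ (sub x S))) (λ S → y∉p (proj₁ S))
    zy : z ≢ y × ¬ Adj G z y
    zy = far-apart epq side-d at-endpoint zd yq (λ S → z∉c (proj₁ (sub z S))) (λ S → y∉p (proj₁ S))
    xz : x ≢ z × ¬ Adj G x z
    xz = far-apart ecd at-endpoint at-endpoint xc zd (λ S → x∉d (proj₂ S)) (λ S → z∉c (proj₁ S))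

  -- (⇐): two different edges with equal labels give a claw.  The edge {c,d}
  -- lies on one side of {a,b}; orient {a,b} so that this is the side of a.
  distinct-labels : ClawFree G → DistinctLabels F
  distinct-labels claw-free a b c d eab ecd same-label
    with (a ≟ c) ×-dec (b ≟ d) | (a ≟ d) ×-dec (b ≟ c)
  ... | yes same | _ = inj₁ same
  ... | no _ | yes flipped = inj₂ flipped
  ... | no n₁ | no n₂ = ⊥-elim (claw-free claw)
    where
    sub : ∀ v → InLabel a b v → InLabel c d v
    sub v (va , vb) = x∈p∩q⁻ (cl c) (cl d) (subst (v ∈_) same-label (x∈p∩q⁺ (va , vb)))
    off : OffEdge a b d c
    off = (λ { (d≡a , c≡b) → n₂ (sym d≡a , sym c≡b) }) , (λ { (d≡b , c≡a) → n₁ (sym c≡a , sym d≡b) })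
    claw : Claw G
    claw with label-nonempty eab
    ... | s , sa , sb with side a b (shared-walk (proj₁ (sub s (sa , sb))) sb)
    ... | inj₁ (w , av) =
      repeated-label-claw eab ecd sub (sa , sb) (w , av) (E-sym ecd ∷ w , off , av)
    ... | inj₂ (w , av) =
      repeated-label-claw (E-sym eab) ecd (λ v S → sub v (proj₂ S , proj₁ S)) (sb , sa)
        (w , av) (E-sym ecd ∷ w , off-swap off , av)

star : ∀ {k} → Fin (suc k) → Fin (suc k) → Bool
star fzero fzero = false
star fzero (fsuc _) = true
star (fsuc _) fzero = true
star (fsuc _) (fsuc _) = false

star-sym : ∀ {k} (i j : Fin (suc k)) → star i j ≡ star j i
star-sym fzero fzero = refl
star-sym fzero (fsuc _) = refl
star-sym (fsuc _) fzero = refl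
star-sym (fsuc _) (fsuc _) = refl

star-loopless : ∀ {k} (i : Fin (suc k)) → star i i ≡ false
star-loopless fzero = refl
star-loopless (fsuc _) = refl

centre-edge : ∀ {k} {i : Fin (suc k)} → i ≢ fzero → star fzero i ≡ true
centre-edge {i = fzero} i≢0 = ⊥-elim (i≢0 refl)
centre-edge {i = fsuc i} _ = refl

star-centre : ∀ {k} (u a b : Fin (suc k)) → a ≢ b → star u a ≡ true → star u b ≡ true → u ≡ fzero
star-centre fzero a b _ _ _ = refl
star-centre (fsuc u) fzero fzero a≢b _ _ = ⊥-elim (a≢b refl)
star-centre (fsuc u) (fsuc a) _ _ () _
star-centre (fsuc u) fzero (fsuc b) _ _ ()

-- In a walk c j₀ , c j₁ , c j₂ , c j₃ through distinct vertices, c j₁ and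
-- c j₂ would both be the centre.
no-two-centres : ∀ {k K} (c : Fin K → Fin (suc k)) → Injective _≡_ _≡_ c → (j₀ j₁ j₂ j₃ : Fin K) →
                 j₀ ≢ j₂ → j₁ ≢ j₃ → j₁ ≢ j₂ →
                 star (c j₀) (c j₁) ≡ true → star (c j₁) (c j₂) ≡ true → star (c j₂) (c j₃) ≡ true → ⊥
no-two-centres c c-inj j₀ j₁ j₂ j₃ j₀≢j₂ j₁≢j₃ j₁≢j₂ e₀₁ e₁₂ e₂₃ =
  j₁≢j₂ (c-inj (trans (centre e₀₁ e₁₂ j₀≢j₂) (sym (centre e₁₂ e₂₃ j₁≢j₃))))
  where
  centre : ∀ {i j l} → star (c i) (c j) ≡ true → star (c j) (c l) ≡ true → i ≢ l → c j ≡ fzero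
  centre {i} {j} {l} e₁ e₂ i≢l =
    star-centre (c j) (c i) (c l) (λ eq → i≢l (c-inj eq)) (trans (star-sym (c j) (c i)) e₁) e₂

-- A cycle of length 3 or of length at least 4 contains such a walk.
star-acyclic : ∀ {k} → Acyclic (star {k})
star-acyclic zero () _ _ _
star-acyclic (suc zero) (s≤s ()) _ _ _
star-acyclic (suc (suc zero)) (s≤s (s≤s ())) _ _ _
star-acyclic (suc (suc (suc zero))) _ c c-inj cycle =
  no-two-centres c c-inj fzero (fsuc fzero) (fsuc (fsuc fzero)) fzero (λ ()) (λ ()) (λ ())
    (cycle _ _ (inj₁ refl)) (cycle _ _ (inj₁ refl)) (cycle _ _ (inj₂ (refl , refl)))
star-acyclic (suc (suc (suc (suc K)))) _ c c-inj cycle =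
  no-two-centres c c-inj fzero (fsuc fzero) (fsuc (fsuc fzero)) (fsuc (fsuc (fsuc fzero))) (λ ()) (λ ()) (λ ())
    (cycle _ _ (inj₁ refl)) (cycle _ _ (inj₁ refl)) (cycle _ _ (inj₁ refl))

record Star {n : ℕ} (G : Graph n) (k : ℕ) : Set where
  field
    centre : Fin n
    leaf   : Fin (suc k) → Fin n
    spoke  : ∀ i → Adj G centre (leaf i)
    apart  : ∀ i j → i ≢ j → leaf i ≢ leaf j × ¬ Adj G (leaf i) (leaf j)

-- The subgraph induced by a star has the spokes {s,ℓᵢ} as its cliques, and
-- the star tree centred at the spoke of leaf 0 is a clique tree of it.  All
-- its edges carry the label {s}.
module StarForest {n k : ℕ} {G : Graph n} (S : Star G k) where
  open Star S renaming (centre to s; leaf to ℓ)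
  open Walks (star {k}) star-sym

  U : Subset n
  U = ⁅ s ⁆ ∪ image ℓ

  K : Fin (suc k) → Subset n
  K i = ⁅ s ⁆ ∪ ⁅ ℓ i ⁆

  open Cliques G U

  s∈U : s ∈ U
  s∈U = x∈p∪q⁺ (inj₁ (x∈⁅x⁆ s))

  ℓ∈U : ∀ i → ℓ i ∈ U
  ℓ∈U i = x∈p∪q⁺ (inj₂ (∈-image ℓ i))

  ∈U : ∀ {v} → v ∈ U → v ≡ s ⊎ ∃ λ i → v ≡ ℓ i
  ∈U h with x∈p∪q⁻ ⁅ s ⁆ (image ℓ) h
  ... | inj₁ h₀ = inj₁ (x∈⁅y⁆⇒x≡y s h₀)
  ... | inj₂ h₁ = inj₂ (image-∈ ℓ h₁)

  K-complete : ∀ i → IsComplete G U (K i)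
  K-complete i = edge-complete (spoke i) s∈U (ℓ∈U i)

  -- A complete set through the leaf ℓ i lies inside the spoke K i, since the
  -- other leaves are not adjacent to ℓ i.
  complete-⊆K : ∀ i D → IsComplete G U D → ℓ i ∈ D → D ⊆ K i
  complete-⊆K i D (D⊆U , D-comp) ℓi∈D {v} v∈D with ∈U (D⊆U v∈D)
  ... | inj₁ refl = pair-left s (ℓ i)
  ... | inj₂ (j , refl) with j ≟ i
  ...   | yes refl = pair-right s (ℓ i)
  ...   | no j≢i = ⊥-elim (proj₂ (apart j i j≢i) (D-comp (ℓ j) (ℓ i) v∈D ℓi∈D (proj₁ (apart j i j≢i))))

  K-clique : ∀ i → IsClique G U (K i)
  K-clique i = (s , pair-left s (ℓ i)) , K-complete i ,
               λ D D-comp K⊆D → ⊆-antisym (complete-⊆K i D D-comp (K⊆D (pair-right s (ℓ i)))) K⊆D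

  K-injective : Injective _≡_ _≡_ K
  K-injective {i} {j} eq with ∈-pair (subst (ℓ i ∈_) eq (pair-right s (ℓ i)))
  ... | inj₁ ℓi≡s = ⊥-elim (adj-irrefl G (spoke i) (sym ℓi≡s))
  ... | inj₂ ℓi≡ℓj with i ≟ j
  ...   | yes i≡j = i≡j
  ...   | no i≢j = ⊥-elim (proj₁ (apart i j i≢j) ℓi≡ℓj)

  -- A clique containing a leaf is that leaf's spoke; one containing no leaf
  -- lies inside ⁅ s ⁆, hence is the spoke K fzero by maximality.
  K-surjective : ∀ C → IsClique G U C → ∃ λ i → K i ≡ C
  K-surjective C (_ , C-comp , C-max) with any? (λ i → ℓ i ∈? C)
  ... | yes (i , ℓi∈C) = i , C-max (K i) (K-complete i) (complete-⊆K i C C-comp ℓi∈C)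
  ... | no no-leaf = fzero , C-max (K fzero) (K-complete fzero) C⊆K₀
    where
    C⊆K₀ : C ⊆ K fzero
    C⊆K₀ v∈C with ∈U (proj₁ C-comp v∈C)
    ... | inj₁ refl = pair-left s (ℓ fzero)
    ... | inj₂ (j , refl) = ⊥-elim (no-leaf (j , v∈C))

  K-meet : ∀ {i j v} → i ≢ j → v ∈ K i → v ∈ K j → v ≡ s
  K-meet {i} {j} i≢j vi vj with ∈-pair vi | ∈-pair vj
  ... | inj₁ v≡s | _ = v≡s
  ... | _ | inj₁ v≡s = v≡s
  ... | inj₂ v≡ℓi | inj₂ v≡ℓj = ⊥-elim (proj₁ (apart i j i≢j) (trans (sym v≡ℓi) v≡ℓj))

  K-label : ∀ {i j} → i ≢ j → K i ∩ K j ≡ ⁅ s ⁆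
  K-label {i} {j} i≢j = ⊆-antisym meet⊆s s⊆meet
    where
    meet⊆s : K i ∩ K j ⊆ ⁅ s ⁆
    meet⊆s {v} h with x∈p∩q⁻ (K i) (K j) h
    ... | vi , vj rewrite K-meet i≢j vi vj = x∈⁅x⁆ s
    s⊆meet : ⁅ s ⁆ ⊆ K i ∩ K j
    s⊆meet {v} h rewrite x∈⁅y⁆⇒x≡y s h = x∈p∩q⁺ (pair-left s (ℓ i) , pair-left s (ℓ j))

  star-path : ∀ (i j : Fin (suc k)) → TPath star i j
  star-path fzero fzero = trivial-path fzero
  star-path fzero (fsuc j) = Trace.path (trace (refl ∷ []) ((λ ()) , tt))
  star-path (fsuc i) fzero = Trace.path (trace (refl ∷ []) ((λ ()) , tt))
  star-path (fsuc i) (fsuc j) with i ≟ j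
  ... | yes refl = trivial-path (fsuc i)
  ... | no i≢j = Trace.path (trace (_∷_ {k = fzero} refl (refl ∷ []))
                   ((λ { (inj₁ ()) ; (inj₂ refl) → i≢j refl }) , (λ ()) , tt))

  -- The clique-tree property: distinct spokes share only s, which lies in
  -- every spoke, and a path between equal ends has a single vertex.
  star-path-prop : ∀ i j (P : TPath (star {k}) i j) t → K i ∩ K j ⊆ K (TPath.vert P t)
  star-path-prop i j P t {v} h with x∈p∩q⁻ (K i) (K j) h | i ≟ j
  ... | vi , vj | no i≢j rewrite K-meet i≢j vi vj = pair-left s (ℓ (TPath.vert P t))
  ... | vi , _ | yes refl rewrite closed-path-trivial P t = vi

  star-forest : CliqueForest G U
  star-forest = record
    { m = suc k ; cl = K ; cl-clique = K-clique ; cl-inj = K-injective ; cl-surj = K-surjective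
    ; tadj = star ; tsym = star-sym ; tirrefl = star-loopless ; acyclic = star-acyclic
    ; connected = λ i j _ → star-path i j
    ; separated = λ i j _ → s , s , pair-left s (ℓ i) , pair-left s (ℓ j) , here s∈U
    ; path-prop = star-path-prop }

  star-repeats-label : ∀ i j → i ≢ j → i ≢ fzero → j ≢ fzero → ¬ DistinctLabels star-forest
  star-repeats-label i j i≢j i≢0 j≢0 distinct
    with distinct fzero i fzero j (centre-edge i≢0) (centre-edge j≢0)
           (trans (K-label (i≢0 ∘ sym)) (sym (K-label (j≢0 ∘ sym))))
  ... | inj₁ (_ , i≡j) = i≢j i≡j
  ... | inj₂ (0≡j , _) = j≢0 (sym 0≡j)

claw-star : ∀ {n} {G : Graph n} → Claw G → Star G 2
claw-star {n} {G} (a , b , c , d , b≢c , b≢d , c≢d , ab , ac , ad , ¬bc , ¬bd , ¬cd) =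
  record { centre = a ; leaf = leaf ; spoke = spoke ; apart = apart }
  where
  leaf : Fin 3 → Fin n
  leaf fzero = b
  leaf (fsuc fzero) = c
  leaf (fsuc (fsuc fzero)) = d
  spoke : ∀ i → Adj G a (leaf i)
  spoke fzero = ab
  spoke (fsuc fzero) = ac
  spoke (fsuc (fsuc fzero)) = ad
  flip : ∀ {u v} → u ≢ v × ¬ Adj G u v → v ≢ u × ¬ Adj G v u
  flip (u≢v , ¬uv) = u≢v ∘ sym , ¬uv ∘ adj-sym G
  apart : ∀ i j → i ≢ j → leaf i ≢ leaf j × ¬ Adj G (leaf i) (leaf j)
  apart fzero (fsuc fzero) _ = b≢c , ¬bc
  apart fzero (fsuc (fsuc fzero)) _ = b≢d , ¬bd
  apart (fsuc fzero) (fsuc (fsuc fzero)) _ = c≢d , ¬cd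
  apart (fsuc fzero) fzero _ = flip (b≢c , ¬bc)
  apart (fsuc (fsuc fzero)) fzero _ = flip (b≢d , ¬bd)
  apart (fsuc (fsuc fzero)) (fsuc fzero) _ = flip (c≢d , ¬cd)
  apart fzero fzero i≢i = ⊥-elim (i≢i refl)
  apart (fsuc fzero) (fsuc fzero) i≢i = ⊥-elim (i≢i refl)
  apart (fsuc (fsuc fzero)) (fsuc (fsuc fzero)) i≢i = ⊥-elim (i≢i refl)

claw-repeats-label : ∀ {n} {G : Graph n} → Claw G →
                     Σ (Subset n) λ U → Σ (CliqueForest G U) λ F → ¬ DistinctLabels F
claw-repeats-label claw = U , star-forest , star-repeats-label (fsuc fzero) (fsuc (fsuc fzero)) (λ ()) (λ ()) (λ ())
  where open StarForest (claw-star claw)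

lemma2p3 : ∀ {n} (G : Graph n) → Chordal G →
    ((∀ (U : Subset n) (F : CliqueForest G U) → DistinctLabels F) ⇔ ClawFree G)
lemma2p3 {n} G _ = mk⇔ claw-free distinct
  where
  claw-free : (∀ U (F : CliqueForest G U) → DistinctLabels F) → ClawFree G
  claw-free all-distinct claw with claw-repeats-label claw
  ... | U , F , repeats = repeats (all-distinct U F)
  distinct : ClawFree G → ∀ U (F : CliqueForest G U) → DistinctLabels F
  distinct no-claw U F = Forest.distinct-labels F no-claw
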